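{- Let $n\ge 1$ be an integer. If $n$ is not a power of $2$, then $f_d(Q_n)\le \frac{p-1}{p}\cdot 2n$, where $p$ is the smallest odd prime factor of $n$. If $n$ is a power of $2$, then $f_d(Q_n)\le 2n$.
   Context: $Q_n$ is the $n$-dimensional hypercube: vertices are binary strings of length $n$, adjacent iff they differ in exactly one position. The \emph{Explorer–Director game} on a finite connected graph $G$ with starting vertex $v$: a token starts on $v$; in each round, with the token on $u$, the Explorer names a distance $d$ such that some vertex is at distance $d$ from $u$, and the Director moves the token to any vertex at distance exactly $d$ from $u$. Visited vertices are those the token has ever occupied (including $v$). The Explorer maximizes and the Director minimizes the number of visited vertices; the game ends when the Director can keep the token on visited vertices indefinitely; $f_d(G,v)$ is the final number of visited vertices under optimal play. Since $Q_n$ is vertex-transitive, $f_d(Q_n,v)$ does not depend on $v$ and is written $f_d(Q_n)$. -}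

module Defs where

open import Data.Nat using (ℕ; zero; suc; _+_; _≤_; _<_)
open import Data.Bool using (Bool; true; false)
import Data.Bool as B
open import Data.Vec using (Vec; []; _∷_; replicate)
open import Data.Vec.Properties using (≡-dec)
open import Data.List using (List; length; deduplicate) renaming ([] to []ₗ; _∷_ to _∷ₗ_)
open import Data.Product using (∃-syntax; _×_)
open import Relation.Nullary using (¬_)
open import Relation.Binary.PropositionalEquality using (_≡_)

V : ℕ → Set
V n = Vec Bool n

diffs : ∀ {n} → V n → V n → ℕ
diffs [] [] = 0
diffs (x ∷ xs) (y ∷ ys) with x B.≟ y
... | Relation.Nullary.yes _ = diffs xs ys
... | Relation.Nullary.no  _ = suc (diffs xs ys)

Adj : ∀ {n} → V n → V n → Set
Adj u w = diffs u w ≡ 1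

data Walk {n : ℕ} : V n → V n → ℕ → Set where
  here : ∀ {u} → Walk u u 0
  step : ∀ {u x w k} → Adj u x → Walk x w k → Walk u w (suc k)

Dist : ∀ {n} → V n → V n → ℕ → Set
Dist u w d = Walk u w d × (∀ k → k < d → ¬ Walk u w k)

card : ∀ {n} → List (V n) → ℕ
card S = length (deduplicate (≡-dec B._≟_) S)

-- Forces k u S : with the token on u and visited list S, the Explorer has a
-- strategy forcing (in finitely many rounds, whatever the Director does) that
-- at least k distinct vertices are visited.
data Forces {n : ℕ} (k : ℕ) : V n → List (V n) → Set where
  done : ∀ {u S} → k ≤ card S → Forces k u S
  move : ∀ {u S} (d : ℕ) → (∃[ w ] Dist u w d)
       → (∀ w → Dist u w d → Forces k w (w ∷ₗ S)) → Forces k u S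

-- start vertex (Q_n is vertex-transitive): 00...0
start : (n : ℕ) → V n
start n = replicate n false

-- f_d(Q_n) is the largest k the Explorer can force from the start.
-- fd≤ n B  means  f_d(Q_n) ≤ B.
fd≤ : ℕ → ℕ → Set
fd≤ n B = ∀ k → Forces k (start n) (start n ∷ₗ []ₗ) → k ≤ B

{-# OPTIONS --safe #-}
module Submission where

-- If the Director can keep the token inside a set T of vertices that contains
-- the start and, from each of its vertices, meets every distance the Explorer
-- may name, then at most |T| vertices are ever visited.
--
-- The staircases 1^a 0^(n-a) and their antipodes form an isometric 2n-cycle
-- in Q_n (staircase a at position a, its antipode at position n + a), and the
-- two cycle vertices at cycle distance d from a given one are at Hamming
-- distance d from it. So the whole cycle is such a T, giving 2n. For an odd
-- prime p dividing n, drop the positions that are -1 modulo p. The two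
-- candidate answers from position a sum to 2a modulo 2n, hence modulo p, so if
-- both were dropped then p ∣ 2(a + 1), and a itself would be dropped. What
-- remains has 2n(p-1)/p vertices.

open import Defs
open import Data.Nat using (ℕ; zero; suc; _+_; _*_; _∸_; _^_; _≤_; _<_; z≤n; s≤s; ∣_-_∣; _≤?_; _<?_)
open import Data.Nat.Properties
open import Data.Nat.Divisibility using (_∣_; _∣?_; divides; ∣-refl; ∣-trans; ∣⇒≤; ∣1⇒≡1; n∣m*n; ∣m∣n⇒∣m+n; ∣m+n∣m⇒∣n)
open import Data.Nat.Primality using (Prime; ¬prime[1]; prime⇒nonZero; irreducible[2]; euclidsLemma)
open import Data.Nat.Tactic.RingSolver using (solve-∀)
open import Data.Bool using (Bool; true; false; not)
import Data.Bool as Bool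
open import Data.Vec using ([]; _∷_)
import Data.Vec as Vec
open import Data.Vec.Properties using (≡-dec)
open import Data.List using (List; []; _∷_; _++_; map; filter; length; downFrom)
open import Data.List.Properties using (length-++; length-map; length-downFrom; length-removeAt′; filter-++; filter-all; filter-reject)
open import Data.List.Membership.Propositional using (_∈_)
open import Data.List.Membership.Propositional.Properties using (∈-++⁺ˡ; ∈-++⁺ʳ; ∈-++⁻; ∈-map⁺; ∈-map⁻; ∈-filter⁺; ∈-filter⁻; ∈-downFrom⁺; ∈-downFrom⁻; ∈-deduplicate⁻)
open import Data.List.Relation.Binary.Subset.Propositional using (_⊆_)
open import Data.List.Relation.Binary.Subset.Propositional.Properties using (∈-∷⁺ʳ)
open import Data.List.Relation.Unary.Any using (here; there; index; _─_)
import Data.List.Relation.Unary.All as All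
open import Data.List.Relation.Unary.AllPairs using (_∷_)
open import Data.List.Relation.Unary.Unique.Propositional using (Unique)
open import Data.List.Relation.Unary.Unique.DecPropositional.Properties using (deduplicate-!)
open import Data.Product using (∃-syntax; ∃₂; _×_; _,_)
open import Data.Sum using (_⊎_; inj₁; inj₂; [_,_]′)
open import Function using (_∘_)
open import Relation.Nullary using (¬_; yes; no; ¬?; contradiction)
open import Relation.Unary using (Decidable)
open import Relation.Binary.PropositionalEquality using (_≡_; _≢_; refl; sym; trans; cong; cong₂; subst; module ≡-Reasoning)

antipode : ∀ {n} → V n → V n
antipode = Vec.map not

diffs-refl : ∀ {n} (u : V n) → diffs u u ≡ 0
diffs-refl []          = refl
diffs-refl (true ∷ u)  = diffs-refl u
diffs-refl (false ∷ u) = diffs-refl u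

diffs≤n : ∀ {n} (u w : V n) → diffs u w ≤ n
diffs≤n []          []          = z≤n
diffs≤n (true ∷ u)  (true ∷ w)  = m≤n⇒m≤1+n (diffs≤n u w)
diffs≤n (true ∷ u)  (false ∷ w) = s≤s (diffs≤n u w)
diffs≤n (false ∷ u) (true ∷ w)  = s≤s (diffs≤n u w)
diffs≤n (false ∷ u) (false ∷ w) = m≤n⇒m≤1+n (diffs≤n u w)

m≤n+o⇒1+m≤n+1+o : ∀ {m} n {o} → m ≤ n + o → suc m ≤ n + suc o
m≤n+o⇒1+m≤n+1+o n m≤n+o = ≤-trans (s≤s m≤n+o) (≤-reflexive (sym (+-suc n _)))

m≤n+o⇒m≤1+n+1+o : ∀ {m} n {o} → m ≤ n + o → m ≤ suc n + suc o
m≤n+o⇒m≤1+n+1+o n m≤n+o = m≤n⇒m≤1+n (≤-trans m≤n+o (+-monoʳ-≤ n (n≤1+n _)))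

diffs-triangle : ∀ {n} (u v w : V n) → diffs u w ≤ diffs u v + diffs v w
diffs-triangle []          []          []          = z≤n
diffs-triangle (true ∷ u)  (true ∷ v)  (true ∷ w)  = diffs-triangle u v w
diffs-triangle (true ∷ u)  (true ∷ v)  (false ∷ w) = m≤n+o⇒1+m≤n+1+o (diffs u v) (diffs-triangle u v w)
diffs-triangle (true ∷ u)  (false ∷ v) (true ∷ w)  = m≤n+o⇒m≤1+n+1+o (diffs u v) (diffs-triangle u v w)
diffs-triangle (true ∷ u)  (false ∷ v) (false ∷ w) = s≤s (diffs-triangle u v w)
diffs-triangle (false ∷ u) (true ∷ v)  (true ∷ w)  = s≤s (diffs-triangle u v w)
diffs-triangle (false ∷ u) (true ∷ v)  (false ∷ w) = m≤n+o⇒m≤1+n+1+o (diffs u v) (diffs-triangle u v w)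
diffs-triangle (false ∷ u) (false ∷ v) (true ∷ w)  = m≤n+o⇒1+m≤n+1+o (diffs u v) (diffs-triangle u v w)
diffs-triangle (false ∷ u) (false ∷ v) (false ∷ w) = diffs-triangle u v w

diffs-antipodeʳ : ∀ {n} (u w : V n) → diffs u (antipode w) + diffs u w ≡ n
diffs-antipodeʳ []          []          = refl
diffs-antipodeʳ (true ∷ u)  (true ∷ w)  = cong suc (diffs-antipodeʳ u w)
diffs-antipodeʳ (true ∷ u)  (false ∷ w) = trans (+-suc _ _) (cong suc (diffs-antipodeʳ u w))
diffs-antipodeʳ (false ∷ u) (true ∷ w)  = trans (+-suc _ _) (cong suc (diffs-antipodeʳ u w))
diffs-antipodeʳ (false ∷ u) (false ∷ w) = cong suc (diffs-antipodeʳ u w)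

diffs-antipodeˡ : ∀ {n} (u w : V n) → diffs (antipode u) w ≡ diffs u (antipode w)
diffs-antipodeˡ []          []          = refl
diffs-antipodeˡ (true ∷ u)  (true ∷ w)  = cong suc (diffs-antipodeˡ u w)
diffs-antipodeˡ (true ∷ u)  (false ∷ w) = diffs-antipodeˡ u w
diffs-antipodeˡ (false ∷ u) (true ∷ w)  = diffs-antipodeˡ u w
diffs-antipodeˡ (false ∷ u) (false ∷ w) = cong suc (diffs-antipodeˡ u w)

diffs-antipode-antipode : ∀ {n} (u w : V n) → diffs (antipode u) (antipode w) ≡ diffs u w
diffs-antipode-antipode []          []          = refl
diffs-antipode-antipode (true ∷ u)  (true ∷ w)  = diffs-antipode-antipode u w
diffs-antipode-antipode (true ∷ u)  (false ∷ w) = cong suc (diffs-antipode-antipode u w)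
diffs-antipode-antipode (false ∷ u) (true ∷ w)  = cong suc (diffs-antipode-antipode u w)
diffs-antipode-antipode (false ∷ u) (false ∷ w) = diffs-antipode-antipode u w

Walk⇒diffs≤ : ∀ {n} {u w : V n} {k} → Walk u w k → diffs u w ≤ k
Walk⇒diffs≤ {u = u} here = ≤-reflexive (diffs-refl u)
Walk⇒diffs≤ {u = u} {w} {suc k} (step {x = x} u~x x⇝w) = begin
  diffs u w             ≤⟨ diffs-triangle u x w ⟩
  diffs u x + diffs x w ≡⟨ cong (_+ diffs x w) u~x ⟩
  suc (diffs x w)       ≤⟨ s≤s (Walk⇒diffs≤ x⇝w) ⟩
  suc k                 ∎
  where open ≤-Reasoning

Walk-∷ : ∀ {n} {u w : V n} {k} (b : Bool) → Walk u w k → Walk (b ∷ u) (b ∷ w) k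
Walk-∷ b     here           = here
Walk-∷ true  (step u~x x⇝w) = step u~x (Walk-∷ true x⇝w)
Walk-∷ false (step u~x x⇝w) = step u~x (Walk-∷ false x⇝w)

diffs-Walk : ∀ {n} (u w : V n) → Walk u w (diffs u w)
diffs-Walk []          []          = here
diffs-Walk (true ∷ u)  (true ∷ w)  = Walk-∷ true (diffs-Walk u w)
diffs-Walk (true ∷ u)  (false ∷ w) = step (cong suc (diffs-refl u)) (Walk-∷ false (diffs-Walk u w))
diffs-Walk (false ∷ u) (true ∷ w)  = step (cong suc (diffs-refl u)) (Walk-∷ true (diffs-Walk u w))
diffs-Walk (false ∷ u) (false ∷ w) = Walk-∷ false (diffs-Walk u w)

diffs⇒Dist : ∀ {n} {u w : V n} {d} → diffs u w ≡ d → Dist u w d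
diffs⇒Dist {u = u} {w} refl = diffs-Walk u w , λ k k<d u⇝w → <⇒≱ k<d (Walk⇒diffs≤ u⇝w)

Dist⇒diffs : ∀ {n} {u w : V n} {d} → Dist u w d → diffs u w ≡ d
Dist⇒diffs {u = u} {w} (u⇝w , shortest) =
  ≤-antisym (Walk⇒diffs≤ u⇝w) (≮⇒≥ λ diffs<d → shortest _ diffs<d (diffs-Walk u w))

Dist⇒≤n : ∀ {n} {u w : V n} {d} → Dist u w d → d ≤ n
Dist⇒≤n {u = u} {w} u~w = subst (_≤ _) (Dist⇒diffs u~w) (diffs≤n u w)

module _ {ℓ} {A : Set ℓ} where

  ∈-─⁺ : ∀ {x z : A} {ys} (x∈ys : x ∈ ys) → z ∈ ys → x ≢ z → z ∈ (ys ─ x∈ys)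
  ∈-─⁺ (here refl)  (here refl)  x≢z = contradiction refl x≢z
  ∈-─⁺ (here refl)  (there z∈ys) _   = z∈ys
  ∈-─⁺ (there _)    (here refl)  _   = here refl
  ∈-─⁺ (there x∈ys) (there z∈ys) x≢z = there (∈-─⁺ x∈ys z∈ys x≢z)

  Unique⇒length≤ : ∀ {xs ys : List A} → Unique xs → xs ⊆ ys → length xs ≤ length ys
  Unique⇒length≤ {[]}     _                 _        = z≤n
  Unique⇒length≤ {x ∷ xs} {ys} (x∉xs ∷ uniq) x∷xs⊆ys = begin
    suc (length xs)          ≤⟨ s≤s (Unique⇒length≤ uniq xs⊆ys─x) ⟩
    suc (length (ys ─ x∈ys)) ≡⟨ length-removeAt′ ys (index x∈ys) ⟨
    length ys                ∎
    where
    open ≤-Reasoning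
    x∈ys = x∷xs⊆ys (here refl)
    xs⊆ys─x : xs ⊆ (ys ─ x∈ys)
    xs⊆ys─x z∈xs = ∈-─⁺ x∈ys (x∷xs⊆ys (there z∈xs)) (All.lookup x∉xs z∈xs)

card≤length : ∀ {n} {S T : List (V n)} → S ⊆ T → card S ≤ length T
card≤length {S = S} S⊆T =
  Unique⇒length≤ (deduplicate-! (≡-dec Bool._≟_) S) (S⊆T ∘ ∈-deduplicate⁻ (≡-dec Bool._≟_) S)

Trap : ∀ {n} → List (V n) → Set
Trap T = ∀ {u d} → u ∈ T → ∃[ w ] Dist u w d → ∃[ w ] w ∈ T × Dist u w d

module _ {n} {T : List (V n)} (trap : Trap T) where

  Forces⇒≤length : ∀ {k u S} → Forces k u S → u ∈ T → S ⊆ T → k ≤ length T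
  Forces⇒≤length (done k≤card)    _   S⊆T = ≤-trans k≤card (card≤length S⊆T)
  Forces⇒≤length (move _ u~ next) u∈T S⊆T with w , w∈T , u~w ← trap u∈T u~ =
    Forces⇒≤length (next w u~w) w∈T (∈-∷⁺ʳ w∈T S⊆T)

  Trap⇒fd≤ : start n ∈ T → fd≤ n (length T)
  Trap⇒fd≤ start∈T k F = Forces⇒≤length F start∈T (∈-∷⁺ʳ start∈T λ ())

staircase : (n a : ℕ) → V n
staircase zero    _       = []
staircase (suc n) zero    = false ∷ staircase n zero
staircase (suc n) (suc a) = true ∷ staircase n a

staircase-zero : ∀ n → staircase n 0 ≡ start n
staircase-zero zero    = refl
staircase-zero (suc n) = cong (false ∷_) (staircase-zero n)

diffs-staircase : ∀ {n a b} → a ≤ n → b ≤ n → diffs (staircase n a) (staircase n b) ≡ ∣ a - b ∣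
diffs-staircase {zero}  z≤n z≤n = refl
diffs-staircase {suc n} {zero}  {zero}  _         _         = diffs-staircase {n} z≤n z≤n
diffs-staircase {suc n} {zero}  {suc b} _         (s≤s b≤n) = cong suc (diffs-staircase z≤n b≤n)
diffs-staircase {suc n} {suc a} {zero}  (s≤s a≤n) _         =
  cong suc (trans (diffs-staircase a≤n z≤n) (∣-∣-identityʳ a))
diffs-staircase {suc n} {suc a} {suc b} (s≤s a≤n) (s≤s b≤n) = diffs-staircase a≤n b≤n

m+o≡n⇒∣m-n∣≡o : ∀ {m n o} → m + o ≡ n → ∣ m - n ∣ ≡ o
m+o≡n⇒∣m-n∣≡o {m} {o = o} refl = ∣m-m+n∣≡n m o

∣-∣-wrap : ∀ {a b d n} → b + n ≡ a + d → d ≤ n → ∣ a - b ∣ + d ≡ n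
∣-∣-wrap {a} {b} {d} {n} b+n≡a+d d≤n = begin
  ∣ a - b ∣ + d ≡⟨ cong (_+ d) (m≤n⇒∣n-m∣≡n∸m b≤a) ⟩
  a ∸ b + d     ≡⟨ +-∸-comm d b≤a ⟨
  a + d ∸ b     ≡⟨ cong (_∸ b) b+n≡a+d ⟨
  b + n ∸ b     ≡⟨ m+n∸m≡n b n ⟩
  n             ∎
  where
  open ≡-Reasoning
  b≤a : b ≤ a
  b≤a = +-cancelʳ-≤ n b a (≤-trans (≤-reflexive b+n≡a+d) (+-monoʳ-≤ a d≤n))

Reaches : (n a d b : ℕ) → Set
Reaches n a d b = diffs (staircase n a) (staircase n b) ≡ d
                ⊎ diffs (staircase n a) (antipode (staircase n b)) ≡ d

reaches-near : ∀ {n a b d} → a ≤ n → b ≤ n → ∣ a - b ∣ ≡ d → Reaches n a d b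
reaches-near a≤n b≤n ∣a-b∣≡d = inj₁ (trans (diffs-staircase a≤n b≤n) ∣a-b∣≡d)

reaches-far : ∀ {n a b d} → a ≤ n → b ≤ n → ∣ a - b ∣ + d ≡ n → Reaches n a d b
reaches-far {n} {a} {b} {d} a≤n b≤n ∣a-b∣+d≡n = inj₂ (+-cancelʳ-≡ ∣ a - b ∣ _ d (begin
  diffs A (antipode B) + ∣ a - b ∣ ≡⟨ cong (diffs A (antipode B) +_) (diffs-staircase a≤n b≤n) ⟨
  diffs A (antipode B) + diffs A B ≡⟨ diffs-antipodeʳ A B ⟩
  n                                ≡⟨ ∣a-b∣+d≡n ⟨
  ∣ a - b ∣ + d                    ≡⟨ +-comm ∣ a - b ∣ d ⟩
  d + ∣ a - b ∣                    ∎))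
  where
  open ≡-Reasoning
  A = staircase n a
  B = staircase n b

step-forward : ∀ {n a} d → a < n → d ≤ n →
  ∃₂ λ b i → b < n × b + i * n ≡ a + d × Reaches n a d b
step-forward {n} {a} d a<n d≤n with a + d <? n
... | yes a+d<n =
  a + d , 0 , a+d<n , +-identityʳ (a + d) , reaches-near (<⇒≤ a<n) (<⇒≤ a+d<n) (∣m-m+n∣≡n a d)
... | no a+d≮n =
  b , 1 , b<n , trans (cong (b +_) (*-identityˡ n)) b+n≡a+d ,
  reaches-far (<⇒≤ a<n) (<⇒≤ b<n) (∣-∣-wrap b+n≡a+d d≤n)
  where
  b = a + d ∸ n
  b+n≡a+d : b + n ≡ a + d
  b+n≡a+d = m∸n+n≡m (≮⇒≥ a+d≮n)
  b<n : b < n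
  b<n = +-cancelʳ-< n b n (subst (_< n + n) (sym b+n≡a+d) (+-mono-<-≤ a<n d≤n))

step-backward : ∀ {n a} d → a < n → d ≤ n →
  ∃₂ λ b j → b < n × b + d ≡ a + j * n × Reaches n a d b
step-backward {n} {a} d a<n d≤n with d ≤? a
... | yes d≤a =
  a ∸ d , 0 , ≤-<-trans (m∸n≤m a d) a<n , trans (m∸n+n≡m d≤a) (sym (+-identityʳ a)) ,
  reaches-near (<⇒≤ a<n) (≤-trans (m∸n≤m a d) (<⇒≤ a<n))
    (trans (∣-∣-comm a (a ∸ d)) (m+o≡n⇒∣m-n∣≡o (m∸n+n≡m d≤a)))
... | no d≰a =
  b , 1 , b<n , trans b+d≡a+n (cong (a +_) (sym (*-identityˡ n))) ,
  reaches-far (<⇒≤ a<n) (<⇒≤ b<n)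
    (trans (cong (_+ d) (∣-∣-comm a b)) (∣-∣-wrap (sym b+d≡a+n) d≤n))
  where
  b = a + n ∸ d
  b+d≡a+n : b + d ≡ a + n
  b+d≡a+n = m∸n+n≡m (≤-trans d≤n (m≤n+m n a))
  b<n : b < n
  b<n = +-cancelʳ-< d b n (begin-strict
    b + d ≡⟨ b+d≡a+n ⟩
    a + n <⟨ +-monoˡ-< n (≰⇒> d≰a) ⟩
    d + n ≡⟨ +-comm d n ⟩
    n + d ∎)
    where open ≤-Reasoning

StepClosed : ℕ → List ℕ → Set
StepClosed n A = ∀ {a} → a ∈ A → ∀ d → d ≤ n → ∃[ b ] b ∈ A × Reaches n a d b

staircases : (n : ℕ) → List ℕ → List (V n)
staircases n A = map (staircase n) A ++ map (antipode ∘ staircase n) A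

module _ {n : ℕ} {A : List ℕ} where

  ∈-staircases⁺ˡ : ∀ {a} → a ∈ A → staircase n a ∈ staircases n A
  ∈-staircases⁺ˡ = ∈-++⁺ˡ ∘ ∈-map⁺ (staircase n)

  ∈-staircases⁺ʳ : ∀ {a} → a ∈ A → antipode (staircase n a) ∈ staircases n A
  ∈-staircases⁺ʳ = ∈-++⁺ʳ _ ∘ ∈-map⁺ (antipode ∘ staircase n)

  ∈-staircases⁻ : ∀ {u} → u ∈ staircases n A →
    ∃[ a ] a ∈ A × (u ≡ staircase n a ⊎ u ≡ antipode (staircase n a))
  ∈-staircases⁻ u∈ with ∈-++⁻ (map (staircase n) A) u∈
  ... | inj₁ u∈ˡ with a , a∈A , u≡ ← ∈-map⁻ (staircase n) u∈ˡ = a , a∈A , inj₁ u≡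
  ... | inj₂ u∈ʳ with a , a∈A , u≡ ← ∈-map⁻ (antipode ∘ staircase n) u∈ʳ = a , a∈A , inj₂ u≡

  length-staircases : length (staircases n A) ≡ 2 * length A
  length-staircases = begin
    length (map (staircase n) A ++ map (antipode ∘ staircase n) A)
      ≡⟨ length-++ (map (staircase n) A) ⟩
    length (map (staircase n) A) + length (map (antipode ∘ staircase n) A)
      ≡⟨ cong₂ _+_ (length-map (staircase n) A) (length-map (antipode ∘ staircase n) A) ⟩
    length A + length A
      ≡⟨ cong (length A +_) (+-identityʳ (length A)) ⟨
    2 * length A ∎
    where open ≡-Reasoning

  reaches⇒answer : ∀ {a b d u} → b ∈ A → (u ≡ staircase n a ⊎ u ≡ antipode (staircase n a)) →
    Reaches n a d b → ∃[ w ] w ∈ staircases n A × diffs u w ≡ d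
  reaches⇒answer {b = b} b∈A (inj₁ refl) (inj₁ near) =
    staircase n b , ∈-staircases⁺ˡ b∈A , near
  reaches⇒answer {b = b} b∈A (inj₁ refl) (inj₂ far) =
    antipode (staircase n b) , ∈-staircases⁺ʳ b∈A , far
  reaches⇒answer {a} {b} b∈A (inj₂ refl) (inj₁ near) =
    antipode (staircase n b) , ∈-staircases⁺ʳ b∈A ,
    trans (diffs-antipode-antipode (staircase n a) (staircase n b)) near
  reaches⇒answer {a} {b} b∈A (inj₂ refl) (inj₂ far) =
    staircase n b , ∈-staircases⁺ˡ b∈A , trans (diffs-antipodeˡ (staircase n a) (staircase n b)) far

  staircases-trap : StepClosed n A → Trap (staircases n A)
  staircases-trap closed u∈ (_ , u~)
    with a , a∈A , u≡ ← ∈-staircases⁻ u∈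
    with b , b∈A , reach ← closed a∈A _ (Dist⇒≤n u~)
    with w , w∈ , uw≡d ← reaches⇒answer b∈A u≡ reach
    = w , w∈ , diffs⇒Dist uw≡d

  StepClosed⇒fd≤ : StepClosed n A → 0 ∈ A → fd≤ n (2 * length A)
  StepClosed⇒fd≤ closed 0∈A =
    subst (fd≤ n) length-staircases (Trap⇒fd≤ (staircases-trap closed) start∈)
    where
    start∈ : start n ∈ staircases n A
    start∈ = subst (_∈ staircases n A) (staircase-zero n) (∈-staircases⁺ˡ 0∈A)

downFrom-stepClosed : ∀ n → StepClosed n (downFrom n)
downFrom-stepClosed n a∈ d d≤n with b , _ , b<n , _ , reach ← step-forward d (∈-downFrom⁻ a∈) d≤n =
  b , ∈-downFrom⁺ b<n , reach

∤suc? : ∀ p → Decidable (λ a → ¬ p ∣ suc a)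
∤suc? p a = ¬? (p ∣? suc a)

notMinusOneMod : ℕ → ℕ → List ℕ
notMinusOneMod p n = filter (∤suc? p) (downFrom n)

∈-notMinusOneMod⁺ : ∀ {p n a} → a < n → ¬ p ∣ suc a → a ∈ notMinusOneMod p n
∈-notMinusOneMod⁺ {p} a<n p∤ = ∈-filter⁺ (∤suc? p) (∈-downFrom⁺ a<n) p∤

∈-notMinusOneMod⁻ : ∀ {p n a} → a ∈ notMinusOneMod p n → a < n × ¬ p ∣ suc a
∈-notMinusOneMod⁻ {p} a∈ with a∈↓ , p∤ ← ∈-filter⁻ (∤suc? p) a∈ = ∈-downFrom⁻ a∈↓ , p∤

odd-prime∤2 : ∀ {p} → Prime p → ¬ 2 ∣ p → ¬ p ∣ 2
odd-prime∤2 pp odd p∣2 with irreducible[2] p∣2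
... | inj₁ refl = ¬prime[1] pp
... | inj₂ refl = odd ∣-refl

opposite-steps-∣ : ∀ {p a b c d m m′} → b + m ≡ a + d → c + d ≡ a + m′ → p ∣ m → p ∣ m′ →
  p ∣ suc b → p ∣ suc c → p ∣ 2 * suc a
opposite-steps-∣ {p} {a} {b} {c} {d} {m} {m′} fwd bwd p∣m p∣m′ p∣b p∣c =
  ∣m+n∣m⇒∣n (subst (p ∣_) sum≡ (∣m∣n⇒∣m+n (∣m∣n⇒∣m+n p∣b p∣c) p∣m)) p∣m′
  where
  open ≡-Reasoning
  sum≡ : suc b + suc c + m ≡ m′ + 2 * suc a
  sum≡ = +-cancelʳ-≡ d (suc b + suc c + m) (m′ + 2 * suc a) (begin
    suc b + suc c + m + d    ≡⟨ regroupˡ b c d m ⟩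
    2 + ((b + m) + (c + d))  ≡⟨ cong (2 +_) (cong₂ _+_ fwd bwd) ⟩
    2 + ((a + d) + (a + m′)) ≡⟨ regroupʳ a d m′ ⟩
    m′ + 2 * suc a + d       ∎)
    where
    regroupˡ : ∀ b c d m → suc b + suc c + m + d ≡ 2 + ((b + m) + (c + d))
    regroupˡ = solve-∀
    regroupʳ : ∀ a d m′ → 2 + ((a + d) + (a + m′)) ≡ m′ + 2 * suc a + d
    regroupʳ = solve-∀

notMinusOneMod-stepClosed : ∀ {p n} → Prime p → ¬ 2 ∣ p → p ∣ n → StepClosed n (notMinusOneMod p n)
notMinusOneMod-stepClosed {p} pp odd p∣n {a} a∈ d d≤n
  with a<n , p∤a ← ∈-notMinusOneMod⁻ a∈
  with b , i , b<n , fwd , reach-b ← step-forward d a<n d≤n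
  with c , j , c<n , bwd , reach-c ← step-backward d a<n d≤n
  with p ∣? suc b | p ∣? suc c
... | no p∤b  | _       = b , ∈-notMinusOneMod⁺ b<n p∤b , reach-b
... | yes _   | no p∤c  = c , ∈-notMinusOneMod⁺ c<n p∤c , reach-c
... | yes p∣b | yes p∣c = contradiction
  (opposite-steps-∣ fwd bwd (∣-trans p∣n (n∣m*n i)) (∣-trans p∣n (n∣m*n j)) p∣b p∣c) p∤2[1+a]
  where
  p∤2[1+a] : ¬ p ∣ 2 * suc a
  p∤2[1+a] p∣ = [ odd-prime∤2 pp odd , p∤a ]′ (euclidsLemma 2 _ pp p∣)

downFrom-+ : ∀ k m → downFrom (k + m) ≡ map (m +_) (downFrom k) ++ downFrom m
downFrom-+ zero    m = refl
downFrom-+ (suc k) m = cong₂ _∷_ (+-comm k m) (downFrom-+ k m)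

filter-∤suc-block : ∀ {p m} → p ∣ m →
  filter (∤suc? p) (map (m +_) (downFrom p)) ≡ map (m +_) (downFrom (p ∸ 1))
filter-∤suc-block {zero}      _   = refl
filter-∤suc-block {suc p} {m} p∣m = begin
  filter P? (m + p ∷ map (m +_) (downFrom p)) ≡⟨ filter-reject P? (λ p∤ → p∤ p∣[1+m+p]) ⟩
  filter P? (map (m +_) (downFrom p))         ≡⟨ filter-all P? (All.tabulate kept) ⟩
  map (m +_) (downFrom p)                     ∎
  where
  open ≡-Reasoning
  P? = ∤suc? (suc p)
  p∣[1+m+p] : suc p ∣ suc (m + p)
  p∣[1+m+p] = subst (suc p ∣_) (+-suc m p) (∣m∣n⇒∣m+n p∣m ∣-refl)
  kept : ∀ {x} → x ∈ map (m +_) (downFrom p) → ¬ suc p ∣ suc x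
  kept x∈ p∣ with i , i∈ , refl ← ∈-map⁻ (m +_) x∈ =
    <⇒≱ (s≤s (∈-downFrom⁻ i∈)) (∣⇒≤ (∣m+n∣m⇒∣n (subst (suc p ∣_) (sym (+-suc m i)) p∣) p∣m))

length-notMinusOneMod : ∀ p q → length (notMinusOneMod p (q * p)) ≡ q * (p ∸ 1)
length-notMinusOneMod p zero    = refl
length-notMinusOneMod p (suc q) = begin
  length (filter P? (downFrom (p + q * p)))
    ≡⟨ cong (length ∘ filter P?) (downFrom-+ p (q * p)) ⟩
  length (filter P? (block ++ downFrom (q * p)))
    ≡⟨ cong length (filter-++ P? block (downFrom (q * p))) ⟩
  length (filter P? block ++ notMinusOneMod p (q * p))
    ≡⟨ length-++ (filter P? block) ⟩
  length (filter P? block) + length (notMinusOneMod p (q * p))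
    ≡⟨ cong₂ _+_ (cong length (filter-∤suc-block {p} (n∣m*n q))) (length-notMinusOneMod p q) ⟩
  length (map (q * p +_) (downFrom (p ∸ 1))) + q * (p ∸ 1)
    ≡⟨ cong (_+ q * (p ∸ 1)) (trans (length-map _ (downFrom (p ∸ 1))) (length-downFrom (p ∸ 1))) ⟩
  p ∸ 1 + q * (p ∸ 1) ∎
  where
  open ≡-Reasoning
  P? = ∤suc? p
  block = map (q * p +_) (downFrom p)

p*2*length-notMinusOneMod : ∀ {p n} → p ∣ n → p * (2 * length (notMinusOneMod p n)) ≡ (p ∸ 1) * (2 * n)
p*2*length-notMinusOneMod {p} (divides q refl) = begin
  p * (2 * length (notMinusOneMod p (q * p))) ≡⟨ cong (λ ℓ → p * (2 * ℓ)) (length-notMinusOneMod p q) ⟩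
  p * (2 * (q * (p ∸ 1)))                     ≡⟨ regroup p (p ∸ 1) q ⟩
  (p ∸ 1) * (2 * (q * p))                     ∎
  where
  open ≡-Reasoning
  regroup : ∀ x y q → x * (2 * (q * y)) ≡ y * (2 * (q * x))
  regroup = solve-∀

fd≤2n : ∀ {n} → 1 ≤ n → fd≤ n (2 * n)
fd≤2n {n} 1≤n = subst (fd≤ n) (cong (2 *_) (length-downFrom n))
  (StepClosed⇒fd≤ (downFrom-stepClosed n) (∈-downFrom⁺ 1≤n))

fd≤-oddPrimeDivisor : ∀ {n p B} → 1 ≤ n → Prime p → ¬ 2 ∣ p → p ∣ n →
  p * B ≡ (p ∸ 1) * (2 * n) → fd≤ n B
fd≤-oddPrimeDivisor {n} {p} {B} 1≤n pp odd p∣n pB≡ = subst (fd≤ n) 2ℓ≡B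
  (StepClosed⇒fd≤ (notMinusOneMod-stepClosed pp odd p∣n) (∈-notMinusOneMod⁺ 1≤n p∤1))
  where
  p∤1 : ¬ p ∣ 1
  p∤1 p∣1 = ¬prime[1] (subst Prime (∣1⇒≡1 p∣1) pp)
  2ℓ≡B : 2 * length (notMinusOneMod p n) ≡ B
  2ℓ≡B = *-cancelˡ-≡ _ B p {{prime⇒nonZero pp}} (trans (p*2*length-notMinusOneMod p∣n) (sym pB≡))

lemma4p3 : (n : ℕ) → 1 ≤ n →
    ((¬ (∃[ m ] n ≡ 2 ^ m)) →
       (p : ℕ) → Prime p → ¬ (2 ∣ p) → p ∣ n →
       (∀ q → Prime q → ¬ (2 ∣ q) → q ∣ n → p ≤ q) →
       ∀ B → p * B ≡ (p ∸ 1) * (2 * n) → fd≤ n B)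
    ×
    ((∃[ m ] n ≡ 2 ^ m) → fd≤ n (2 * n))
lemma4p3 n 1≤n =
  (λ _ p pp odd p∣n _ B pB≡ → fd≤-oddPrimeDivisor 1≤n pp odd p∣n pB≡) ,
  (λ _ → fd≤2n 1≤n)
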